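{- (1) For every type environment $\Gamma$ and term $M$ such that $\Gamma$ is OK, $\mathrm{dom}(\Gamma)=\mathrm{fv}(M)$ and $d(M)=K$, we have $M:\langle\Gamma\vdash\omega^K\rangle$. (2) If $M:\langle\Gamma\vdash U\rangle$, then $\mathrm{dom}(\Gamma)=\mathrm{fv}(M)$. (3) If $M_1:\langle\Gamma_1\vdash U\rangle$ and $M_2:\langle\Gamma_2\vdash V\rangle$, then $\Gamma_1\diamond\Gamma_2$ iff $M_1\diamond M_2$.
   Context: Indexes: finite sequences of natural numbers ($\mathcal L_{\mathbb N}$), $\oslash$ empty, $i::L$ prepending $i$, $L_1\preceq L_2$ (also $L_2\succeq L_1$) iff $L_2=L_1::L_3$ for some $L_3$ (concatenation). Terms: over a countably infinite set $\mathcal V$, terms $\mathcal M$, free indexed variables $\mathrm{fv}$, degree $d$, joinability $\diamond$ defined simultaneously: $x^L\in\mathcal M$ ($\mathrm{fv}=\{x^L\}$, $d=L$); $MN\in\mathcal M$ when $d(M)\preceq d(N)$, $M\diamond N$ ($\mathrm{fv}$ union, $d(MN)=d(M)$); $\lambda x^L.M\in\mathcal M$ when $L\succeq d(M)$ ($\mathrm{fv}(M)\setminus\{x^L\}$, $d=d(M)$). $M\diamond N$ iff $x^L\in\mathrm{fv}(M)$, $x^K\in\mathrm{fv}(N)$ imply $L=K$. Terms modulo $\alpha$. Lifting $(x^L)^{+i}=x^{i::L}$, $(M_1M_2)^{+i}=M_1^{+i}M_2^{+i}$, $(\lambda x^L.M)^{+i}=\lambda x^{i::L}.M^{+i}$.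 Types: atomic types $\mathcal A$, expansion variables $\overline e_0,\overline e_1,\dots$; $\mathbb T\subseteq\mathbb U$ with degree: $a\in\mathbb T$ ($d=\oslash$); $U\to T\in\mathbb T$ for $U\in\mathbb U,T\in\mathbb T$ ($d=\oslash$); $\omega^L\in\mathbb U$ ($d=L$); $U_1\sqcap U_2$ if $d(U_1)=d(U_2)$; $\overline e_iU$ ($d=i::d(U)$); modulo $\sqcap$ commutative, associative, idempotent, $\overline e_i(U_1\sqcap U_2)=\overline e_iU_1\sqcap\overline e_iU_2$, $\omega^L\sqcap U=U$ ($d(U)=L$), $\overline e_i\omega^K=\omega^{i::K}$. Environments: finite sets of declarations $x^L:U$ (at most one per $x^L$); $\Gamma,\Delta$ disjoint union; $env^\omega_M$ assigns $\omega^L$ to each $x^L\in\mathrm{fv}(M)$; $\Gamma$ is OK iff $d(U)=L$ for every $x^L:U\in\Gamma$; $\Gamma_1\sqcap\Gamma_2$ intersects types of common variables, keeps others; $\overline e_j\Gamma$ replaces $x^L:U$ by $x^{j::L}:\overline e_jU$; $\Gamma_1\diamond\Gamma_2$ iff $x^L\in\mathrm{dom}\,\Gamma_1$, $x^K\in\mathrm{dom}\,\Gamma_2$ imply $L=K$. Subtyping $\sqsubseteq$: least relation on types, environments and typings closed under reflexivity, transitivity, $U_1\sqcap U_2\sqsubseteq U_1$ ($d(U_1)=d(U_2)$), $U_1\sqcap U_2\sqsubseteq V_1\sqcap V_2$ if $U_i\sqsubseteq V_i$, $U_1\to T_1\sqsubseteq U_2\to T_2$ if $U_2\sqsubseteq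 U_1$, $T_1\sqsubseteq T_2$, $\overline e_iU_1\sqsubseteq\overline e_iU_2$ if $U_1\sqsubseteq U_2$, $\Gamma,y^L:U_1\sqsubseteq\Gamma,y^L:U_2$ if $U_1\sqsubseteq U_2$, $\langle\Gamma_1\vdash U_1\rangle\sqsubseteq\langle\Gamma_2\vdash U_2\rangle$ if $U_1\sqsubseteq U_2$, $\Gamma_2\sqsubseteq\Gamma_1$. Typing rules ($T\in\mathbb T$): (ax) $x^\oslash:\langle(x^\oslash:T)\vdash T\rangle$; ($\omega$) $M:\langle env^\omega_M\vdash\omega^{d(M)}\rangle$; ($\to_I$) $M:\langle\Gamma,(x^L:U)\vdash T\rangle\Rightarrow\lambda x^L.M:\langle\Gamma\vdash U\to T\rangle$; ($\to'_I$) $M:\langle\Gamma\vdash T\rangle$, $x^L\notin\mathrm{dom}\,\Gamma\Rightarrow\lambda x^L.M:\langle\Gamma\vdash\omega^L\to T\rangle$; ($\to_E$) $M_1:\langle\Gamma_1\vdash U\to T\rangle$, $M_2:\langle\Gamma_2\vdash U\rangle$, $\Gamma_1\diamond\Gamma_2\Rightarrow M_1M_2:\langle\Gamma_1\sqcap\Gamma_2\vdash T\rangle$; ($\sqcap_I$) $M:\langle\Gamma\vdash U_1\rangle$, $M:\langle\Gamma\vdash U_2\rangle\Rightarrow M:\langle\Gamma\vdash U_1\sqcap U_2\rangle$; ($e$) $M:\langle\Gamma\vdash U\rangle\Rightarrow M^{+j}:\langle\overline e_j\Gamma\vdash\overline e_jU\rangle$; ($\sqsubseteq$) $M:\langle\Gamma\vdash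 U\rangle$, $\langle\Gamma\vdash U\rangle\sqsubseteq\langle\Gamma'\vdash U'\rangle\Rightarrow M:\langle\Gamma'\vdash U'\rangle$. -}

module Defs where

open import Data.Nat using (ℕ) renaming (_≟_ to _≟ℕ_)
open import Data.List using (List; []; _∷_; _++_; filter)
import Data.List.Properties as LP
import Data.Product.Properties as PP
open import Data.List.Membership.Propositional using (_∈_)
open import Data.List.Membership.DecPropositional using () renaming (_∈?_ to mem?)
open import Data.Product using (Σ; ∃; _×_; _,_)
open import Data.Maybe using (Maybe; just; nothing) renaming (map to mmap)
open import Data.Bool using (if_then_else_)
open import Relation.Binary.PropositionalEquality using (_≡_; _≢_)
open import Relation.Binary using (DecidableEquality)
open import Relation.Nullary using (¬_; ¬?; does)

Index : Set
Index = List ℕ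

_⪯_ : Index → Index → Set
L₁ ⪯ L₂ = ∃ λ L₃ → L₂ ≡ L₁ ++ L₃

-- indexed variables x^L ; the countably infinite set 𝒱 is ℕ
Var : Set
Var = ℕ × Index

_≟V_ : DecidableEquality Var
_≟V_ = PP.≡-dec _≟ℕ_ (LP.≡-dec _≟ℕ_)

-- Terms (raw syntax; well-formedness is the predicate WF below)

data Term : Set where
  var : ℕ → Index → Term
  app : Term → Term → Term
  lam : ℕ → Index → Term → Term

fv : Term → List Var
fv (var x L)   = (x , L) ∷ []
fv (app M N)   = fv M ++ fv N
fv (lam x L M) = filter (λ w → ¬? (w ≟V (x , L))) (fv M)

_∈fv_ : Var → Term → Set
v ∈fv M = v ∈ fv M

deg : Term → Index
deg (var x L)   = L
deg (app M N)   = deg M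
deg (lam x L M) = deg M

_⋄_ : Term → Term → Set
M ⋄ N = ∀ x L K → (x , L) ∈fv M → (x , K) ∈fv N → L ≡ K

data WF : Term → Set where
  wf-var : ∀ x L → WF (var x L)
  wf-app : ∀ {M N} → WF M → WF N → deg M ⪯ deg N → M ⋄ N → WF (app M N)
  wf-lam : ∀ {x L M} → WF M → deg M ⪯ L → WF (lam x L M)

lift : ℕ → Term → Term
lift i (var x L)   = var x (i ∷ L)
lift i (app M N)   = app (lift i M) (lift i N)
lift i (lam x L M) = lam x (i ∷ L) (lift i M)

infixr 7 _⇒_
infixl 8 _⊓_

data Ty : Set where
  atom : ℕ → Ty              -- atomic types 𝒜 (taken to be ℕ)
  _⇒_  : Ty → Ty → Ty
  ω    : Index → Ty
  _⊓_  : Ty → Ty → Ty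
  ē    : ℕ → Ty → Ty

degT : Ty → Index
degT (atom a)  = []
degT (U ⇒ T)   = []
degT (ω L)     = L
degT (U ⊓ V)   = degT U
degT (ē i U)   = i ∷ degT U

mutual
  data IsT : Ty → Set where
    t-atom : ∀ a → IsT (atom a)
    t-arr  : ∀ {U T} → WfU U → IsT T → IsT (U ⇒ T)

  data WfU : Ty → Set where
    u-T : ∀ {T} → IsT T → WfU T
    u-ω : ∀ L → WfU (ω L)
    u-⊓ : ∀ {U V} → WfU U → WfU V → degT U ≡ degT V → WfU (U ⊓ V)
    u-ē : ∀ {U} i → WfU U → WfU (ē i U)

infix 4 _≈_
data _≈_ : Ty → Ty → Set where
  ≈-refl  : ∀ {U} → U ≈ U
  ≈-sym   : ∀ {U V} → U ≈ V → V ≈ U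
  ≈-trans : ∀ {U V W} → U ≈ V → V ≈ W → U ≈ W
  ≈-⇒     : ∀ {U U' T T'} → U ≈ U' → T ≈ T' → U ⇒ T ≈ U' ⇒ T'
  ≈-⊓     : ∀ {U U' V V'} → U ≈ U' → V ≈ V' → U ⊓ V ≈ U' ⊓ V'
  ≈-ē     : ∀ {U U'} i → U ≈ U' → ē i U ≈ ē i U'
  ⊓-comm  : ∀ {U V} → U ⊓ V ≈ V ⊓ U
  ⊓-assoc : ∀ {U V W} → (U ⊓ V) ⊓ W ≈ U ⊓ (V ⊓ W)
  ⊓-idem  : ∀ {U} → U ⊓ U ≈ U
  ē-⊓     : ∀ {U V} i → ē i (U ⊓ V) ≈ ē i U ⊓ ē i V
  ω-unit  : ∀ {L U} → degT U ≡ L → ω L ⊓ U ≈ U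
  ē-ω     : ∀ i K → ē i (ω K) ≈ ω (i ∷ K)

infix 4 _⊑_
data _⊑_ : Ty → Ty → Set where
  ⊑-refl  : ∀ {U} → U ⊑ U
  ⊑-≈     : ∀ {U V} → U ≈ V → U ⊑ V
  ⊑-trans : ∀ {U V W} → U ⊑ V → V ⊑ W → U ⊑ W
  ⊑-⊓ₑ    : ∀ {U₁ U₂} → degT U₁ ≡ degT U₂ → U₁ ⊓ U₂ ⊑ U₁
  ⊑-⊓     : ∀ {U₁ U₂ V₁ V₂} → U₁ ⊑ V₁ → U₂ ⊑ V₂ → U₁ ⊓ U₂ ⊑ V₁ ⊓ V₂
  ⊑-⇒     : ∀ {U₁ U₂ T₁ T₂} → U₂ ⊑ U₁ → T₁ ⊑ T₂ → U₁ ⇒ T₁ ⊑ U₂ ⇒ T₂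
  ⊑-ē     : ∀ {U₁ U₂} i → U₁ ⊑ U₂ → ē i U₁ ⊑ ē i U₂

-- Environments: finite partial maps from indexed variables to types
-- (at most one declaration per x^L), represented by their lookup function.

Env : Set
Env = Var → Maybe Ty

_∈dom_ : Var → Env → Set
v ∈dom Γ = ∃ λ U → Γ v ≡ just U

single : Var → Ty → Env
single v U w = if does (w ≟V v) then just U else nothing

-- Γ , (v : U)   (used together with the side condition v ∉ dom Γ)
extend : Env → Var → Ty → Env
extend Γ v U w = if does (w ≟V v) then just U else Γ w

envω : Term → Env
envω M (x , L) = if does (mem? _≟V_ (x , L) (fv M)) then just (ω L) else nothing

OK : Env → Set
OK Γ = ∀ x L U → Γ (x , L) ≡ just U → degT U ≡ L

WfEnv : Env → Set
WfEnv Γ = ∀ v U → Γ v ≡ just U → WfU U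

infixl 6 _⊓E_
_⊓E_ : Env → Env → Env
(Γ₁ ⊓E Γ₂) v with Γ₁ v | Γ₂ v
... | just U  | just V  = just (U ⊓ V)
... | just U  | nothing = just U
... | nothing | just V  = just V
... | nothing | nothing = nothing

ēE : ℕ → Env → Env
ēE j Γ (x , [])    = nothing
ēE j Γ (x , i ∷ L) = if does (i ≟ℕ j) then mmap (ē j) (Γ (x , L)) else nothing

_⋄E_ : Env → Env → Set
Γ₁ ⋄E Γ₂ = ∀ x L K → (x , L) ∈dom Γ₁ → (x , K) ∈dom Γ₂ → L ≡ K

-- subtyping on environments (environments are sets of declarations, so
-- pointwise-equal environments are identified via ⊑E-≃)
infix 4 _⊑E_
data _⊑E_ : Env → Env → Set where
  ⊑E-≃     : ∀ {Γ Δ} → (∀ v → Γ v ≡ Δ v) → Γ ⊑E Δ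
  ⊑E-trans : ∀ {Γ Δ Θ} → Γ ⊑E Δ → Δ ⊑E Θ → Γ ⊑E Θ
  ⊑E-pt    : ∀ {Γ Δ} y U₁ U₂ → Γ y ≡ just U₁ → Δ y ≡ just U₂ → U₁ ⊑ U₂ →
             (∀ v → v ≢ y → Γ v ≡ Δ v) → Γ ⊑E Δ

TypingSub : Env → Ty → Env → Ty → Set
TypingSub Γ₁ U₁ Γ₂ U₂ = (U₁ ⊑ U₂) × (Γ₂ ⊑E Γ₁)

data _∶⟨_⊢_⟩ : Term → Env → Ty → Set where
  ax   : ∀ {x T} → IsT T → var x [] ∶⟨ single (x , []) T ⊢ T ⟩
  ωr   : ∀ {M} → WF M → M ∶⟨ envω M ⊢ ω (deg M) ⟩
  ⇒I   : ∀ {Γ x L U M T} → IsT T → WF (lam x L M) → ¬ ((x , L) ∈dom Γ) →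
         M ∶⟨ extend Γ (x , L) U ⊢ T ⟩ → lam x L M ∶⟨ Γ ⊢ U ⇒ T ⟩
  ⇒I'  : ∀ {Γ x L M T} → IsT T → WF (lam x L M) → ¬ ((x , L) ∈dom Γ) →
         M ∶⟨ Γ ⊢ T ⟩ → lam x L M ∶⟨ Γ ⊢ ω L ⇒ T ⟩
  ⇒E   : ∀ {Γ₁ Γ₂ M₁ M₂ U T} → IsT T → WF (app M₁ M₂) →
         M₁ ∶⟨ Γ₁ ⊢ U ⇒ T ⟩ → M₂ ∶⟨ Γ₂ ⊢ U ⟩ → Γ₁ ⋄E Γ₂ →
         app M₁ M₂ ∶⟨ Γ₁ ⊓E Γ₂ ⊢ T ⟩
  ⊓I   : ∀ {Γ M U₁ U₂} → degT U₁ ≡ degT U₂ →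
         M ∶⟨ Γ ⊢ U₁ ⟩ → M ∶⟨ Γ ⊢ U₂ ⟩ → M ∶⟨ Γ ⊢ U₁ ⊓ U₂ ⟩
  eR   : ∀ {Γ M U} j → M ∶⟨ Γ ⊢ U ⟩ → lift j M ∶⟨ ēE j Γ ⊢ ē j U ⟩
  sub  : ∀ {Γ Γ' M U U'} → M ∶⟨ Γ ⊢ U ⟩ → WfEnv Γ' → WfU U' →
         TypingSub Γ U Γ' U' → M ∶⟨ Γ' ⊢ U' ⟩

DomFv : Env → Term → Set
DomFv Γ M = ∀ v → (v ∈dom Γ → v ∈fv M) × (v ∈fv M → v ∈dom Γ)

module Submission where

open import Defs
open import Data.Product using (_×_)
open import Relation.Binary.PropositionalEquality using (_≡_)

open import Data.Nat using () renaming (_≟_ to _≟ℕ_)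
open import Data.List using (List; []; _∷_)
open import Data.List.Membership.Propositional using (_∉_)
open import Data.List.Membership.DecPropositional using () renaming (_∈?_ to mem?)
open import Data.List.Membership.Propositional.Properties
  using (∈-++⁺ˡ; ∈-++⁺ʳ; ∈-++⁻; ∈-filter⁺; ∈-filter⁻)
open import Data.List.Relation.Unary.Any using (here; there)
open import Data.Maybe using (just; nothing) renaming (map to mmap)
open import Data.Bool using (if_then_else_)
open import Data.Maybe.Relation.Binary.Pointwise as Pointwise using (Pointwise; just; nothing)
open import Data.Product using (∃; _,_; proj₁; proj₂)
open import Data.Sum using (_⊎_; inj₁; inj₂; [_,_])
open import Data.Empty using (⊥-elim)
open import Relation.Nullary using (¬_; ¬?; Dec; does; yes; no)
open import Relation.Binary.PropositionalEquality using (refl; sym; trans; _≢_)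

-- (2) dom Γ = fv M is an invariant of every typing rule, so it is proved by
--     induction on the derivation.  Each rule is handled by a small lemma
--     saying how DomFv propagates through the corresponding term former and
--     environment operation (extension, Γ₁ ⊓ Γ₂, ē_j Γ, subtyping), which in
--     turn rests on membership facts for fv and for env domains.
-- (3) Joinability of environments only looks at their domains, joinability
--     of terms only at their free variables; so by (2) the two notions
--     coincide for the environments of any two typings.
-- (1) The rule (ω) types M with env^ω_M, which has the same domain as Γ and
--     declares ω^L at x^L.  Since Γ is OK, every declared U satisfies
--     U ⊑ ω^(d U) = ω^L, so Γ ⊑ env^ω_M pointwise; a pointwise subtyping on
--     a finite support is a chain of single-point steps, hence Γ ⊑E env^ω_M
--     and rule (⊑) concludes.

∈fv-lam⁺ : ∀ {x L} M {v} → v ∈fv M → v ≢ (x , L) → v ∈fv lam x L M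
∈fv-lam⁺ {x} {L} _ = ∈-filter⁺ (λ w → ¬? (w ≟V (x , L)))

∈fv-lam⁻ : ∀ {x L} M {v} → v ∈fv lam x L M → v ∈fv M × v ≢ (x , L)
∈fv-lam⁻ {x} {L} M = ∈-filter⁻ (λ w → ¬? (w ≟V (x , L))) {xs = fv M}

∈fv-lift⁺ : ∀ j M {x L} → (x , L) ∈fv M → (x , j ∷ L) ∈fv lift j M
∈fv-lift⁺ j (var y K) (here refl) = here refl
∈fv-lift⁺ j (app M N) p with ∈-++⁻ (fv M) p
... | inj₁ q = ∈-++⁺ˡ (∈fv-lift⁺ j M q)
... | inj₂ q = ∈-++⁺ʳ (fv (lift j M)) (∈fv-lift⁺ j N q)
∈fv-lift⁺ j (lam y K M) p =
  let q , fresh = ∈fv-lam⁻ M p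
  in ∈fv-lam⁺ (lift j M) (∈fv-lift⁺ j M q) (λ { refl → fresh refl })

∈fv-lift⁻ : ∀ j M {x K} → (x , K) ∈fv lift j M → ∃ λ L → K ≡ j ∷ L × (x , L) ∈fv M
∈fv-lift⁻ j (var y K) (here refl) = K , refl , here refl
∈fv-lift⁻ j (app M N) p with ∈-++⁻ (fv (lift j M)) p
... | inj₁ q = let L , e , r = ∈fv-lift⁻ j M q in L , e , ∈-++⁺ˡ r
... | inj₂ q = let L , e , r = ∈fv-lift⁻ j N q in L , e , ∈-++⁺ʳ (fv M) r
∈fv-lift⁻ j (lam y K M) p with ∈fv-lam⁻ (lift j M) p
... | q , fresh with ∈fv-lift⁻ j M q
...   | L , refl , r = L , refl , ∈fv-lam⁺ M r (λ { refl → fresh refl })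

extend-other : ∀ Γ w U {v} → v ≢ w → extend Γ w U v ≡ Γ v
extend-other Γ w U {v} v≢w with v ≟V w
... | yes v≡w = ⊥-elim (v≢w v≡w)
... | no _    = refl

∈dom-⊓E⁻ : ∀ Γ₁ Γ₂ v → v ∈dom (Γ₁ ⊓E Γ₂) → v ∈dom Γ₁ ⊎ v ∈dom Γ₂
∈dom-⊓E⁻ Γ₁ Γ₂ v (W , p) with Γ₁ v | Γ₂ v | p
... | just U  | _       | _ = inj₁ (U , refl)
... | nothing | just V  | _ = inj₂ (V , refl)
... | nothing | nothing | ()

∈dom-⊓E⁺ˡ : ∀ Γ₁ Γ₂ v → v ∈dom Γ₁ → v ∈dom (Γ₁ ⊓E Γ₂)
∈dom-⊓E⁺ˡ Γ₁ Γ₂ v (U , p) with Γ₁ v | Γ₂ v | p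
... | just _ | just _  | refl = _ , refl
... | just _ | nothing | refl = _ , refl

∈dom-⊓E⁺ʳ : ∀ Γ₁ Γ₂ v → v ∈dom Γ₂ → v ∈dom (Γ₁ ⊓E Γ₂)
∈dom-⊓E⁺ʳ Γ₁ Γ₂ v (V , p) with Γ₁ v | Γ₂ v | p
... | just _  | just _ | refl = _ , refl
... | nothing | just _ | refl = _ , refl

-- The entry of ē_j Γ at x^(i::L) is a conditional on a decision of i = j;
-- the two entry lemmas analyse an arbitrary such decision, since the
-- condition unfolds to a boolean test that `with` cannot abstract over.
ēE-entry⁺ : ∀ {j U} (j≟j : Dec (j ≡ j)) m → m ≡ just U →
            ∃ λ W → (if does j≟j then mmap (ē j) m else nothing) ≡ just W
ēE-entry⁺ (yes _)  (just _) refl = _ , refl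
ēE-entry⁺ (no j≢j) _        _    = ⊥-elim (j≢j refl)

ēE-entry⁻ : ∀ {i j W} (i≟j : Dec (i ≡ j)) m →
            (if does i≟j then mmap (ē j) m else nothing) ≡ just W → i ≡ j × ∃ λ U → m ≡ just U
ēE-entry⁻ (yes i≡j) (just U) _ = i≡j , U , refl

∈dom-ēE⁺ : ∀ j Γ {x L} → (x , L) ∈dom Γ → (x , j ∷ L) ∈dom ēE j Γ
∈dom-ēE⁺ j Γ {x} {L} (U , p) = ēE-entry⁺ (j ≟ℕ j) (Γ (x , L)) p

∈dom-ēE⁻ : ∀ j Γ {x K} → (x , K) ∈dom ēE j Γ → ∃ λ L → K ≡ j ∷ L × (x , L) ∈dom Γ
∈dom-ēE⁻ j Γ {x} {i ∷ L} (W , p) with ēE-entry⁻ (i ≟ℕ j) (Γ (x , L)) p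
... | refl , x∈Γ = L , refl , x∈Γ

⊑E-dom : ∀ {Γ Δ} → Γ ⊑E Δ → ∀ v → (v ∈dom Γ → v ∈dom Δ) × (v ∈dom Δ → v ∈dom Γ)
⊑E-dom (⊑E-≃ Γ≗Δ) v =
  (λ { (U , p) → U , trans (sym (Γ≗Δ v)) p }) , (λ { (U , p) → U , trans (Γ≗Δ v) p })
⊑E-dom (⊑E-trans Γ⊑Δ Δ⊑Θ) v =
  let to₁ , from₁ = ⊑E-dom Γ⊑Δ v
      to₂ , from₂ = ⊑E-dom Δ⊑Θ v
  in (λ d → to₂ (to₁ d)) , (λ d → from₁ (from₂ d))
⊑E-dom (⊑E-pt y U₁ U₂ p q _ same) v with v ≟V y
... | yes refl = (λ _ → U₂ , q) , (λ _ → U₁ , p)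
... | no v≢y   =
  (λ { (U , r) → U , trans (sym (same v v≢y)) r }) , (λ { (U , r) → U , trans (same v v≢y) r })

domFv-single : ∀ x T → DomFv (single (x , []) T) (var x [])
domFv-single x T v with v ≟V (x , [])
... | yes refl = (λ _ → here refl) , (λ _ → T , refl)
... | no v≢x   = (λ { (_ , ()) }) , (λ { (here v≡x) → ⊥-elim (v≢x v≡x) })

domFv-envω : ∀ M → DomFv (envω M) M
domFv-envω M (x , L) with mem? _≟V_ (x , L) (fv M)
... | yes x∈M = (λ _ → x∈M) , (λ _ → ω L , refl)
... | no x∉M  = (λ { (_ , ()) }) , (λ x∈M → ⊥-elim (x∉M x∈M))

domFv-lam : ∀ {Γ x L} M → ¬ (x , L) ∈dom Γ →
            (∀ v → v ≢ (x , L) → (v ∈dom Γ → v ∈fv M) × (v ∈fv M → v ∈dom Γ)) →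
            DomFv Γ (lam x L M)
domFv-lam M x∉Γ away v =
  (λ v∈Γ → let v≢x = λ { refl → x∉Γ v∈Γ } in ∈fv-lam⁺ M (proj₁ (away v v≢x) v∈Γ) v≢x) ,
  (λ v∈λ → let v∈M , v≢x = ∈fv-lam⁻ M v∈λ in proj₂ (away v v≢x) v∈M)

domFv-app : ∀ {Γ₁ Γ₂} M₁ M₂ → DomFv Γ₁ M₁ → DomFv Γ₂ M₂ → DomFv (Γ₁ ⊓E Γ₂) (app M₁ M₂)
domFv-app {Γ₁} {Γ₂} M₁ _ D₁ D₂ v =
  let to₁ , from₁ = D₁ v
      to₂ , from₂ = D₂ v
  in (λ v∈Γ → [ (λ a → ∈-++⁺ˡ (to₁ a)) , (λ b → ∈-++⁺ʳ (fv M₁) (to₂ b)) ] (∈dom-⊓E⁻ Γ₁ Γ₂ v v∈Γ)) ,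
     (λ v∈M → [ (λ a → ∈dom-⊓E⁺ˡ Γ₁ Γ₂ v (from₁ a)) , (λ b → ∈dom-⊓E⁺ʳ Γ₁ Γ₂ v (from₂ b)) ]
                (∈-++⁻ (fv M₁) v∈M))

-- rule (e): ē_j and lifting both prefix every index with j
domFv-lift : ∀ j {Γ} M → DomFv Γ M → DomFv (ēE j Γ) (lift j M)
domFv-lift j {Γ} M D (x , K) = to , from
  where
  to : (x , K) ∈dom ēE j Γ → (x , K) ∈fv lift j M
  to d with ∈dom-ēE⁻ j Γ {x} {K} d
  ... | L , refl , d' = ∈fv-lift⁺ j M (proj₁ (D (x , L)) d')
  from : (x , K) ∈fv lift j M → (x , K) ∈dom ēE j Γ
  from m with ∈fv-lift⁻ j M {x} {K} m
  ... | L , refl , m' = ∈dom-ēE⁺ j Γ (proj₂ (D (x , L)) m')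

domFv-⊑E : ∀ {Γ Δ} M → Δ ⊑E Γ → DomFv Γ M → DomFv Δ M
domFv-⊑E _ Δ⊑Γ D v =
  let to , from = D v
      toΓ , fromΓ = ⊑E-dom Δ⊑Γ v
  in (λ d → to (toΓ d)) , (λ m → fromΓ (from m))

domFv : ∀ {M Γ U} → M ∶⟨ Γ ⊢ U ⟩ → DomFv Γ M
domFv (ax {x} {T} _)            = domFv-single x T
domFv (ωr {M} _)                = domFv-envω M
domFv (⇒I {Γ} {x} {L} {U} {M} _ _ x∉Γ d) =
  domFv-lam M x∉Γ λ v v≢x →
    let to , from = domFv d v
        same = extend-other Γ (x , L) U v≢x
    in (λ { (W , p) → to (W , trans same p) }) ,
       (λ m → let W , p = from m in W , trans (sym same) p)
domFv (⇒I' {M = M} _ _ x∉Γ d)   = domFv-lam M x∉Γ (λ v _ → domFv d v)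
domFv (⇒E {M₁ = M₁} {M₂} _ _ d₁ d₂ _) = domFv-app M₁ M₂ (domFv d₁) (domFv d₂)
domFv (⊓I _ d _)                = domFv d
domFv (eR {M = M} j d)          = domFv-lift j M (domFv d)
domFv (sub {M = M} d _ _ (_ , Γ'⊑Γ)) = domFv-⊑E M Γ'⊑Γ (domFv d)

⋄E⇔⋄ : ∀ {Γ₁ Γ₂} M₁ M₂ → DomFv Γ₁ M₁ → DomFv Γ₂ M₂ →
       (Γ₁ ⋄E Γ₂ → M₁ ⋄ M₂) × (M₁ ⋄ M₂ → Γ₁ ⋄E Γ₂)
⋄E⇔⋄ _ _ D₁ D₂ =
  (λ join x L K m n → join x L K (proj₂ (D₁ (x , L)) m) (proj₂ (D₂ (x , K)) n)) ,
  (λ join x L K m n → join x L K (proj₁ (D₁ (x , L)) m) (proj₁ (D₂ (x , K)) n))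

-- every type lies below ω at its own degree:  U ≈ ω^L ⊓ U ⊑ ω^L
⊑-ω : ∀ {U L} → degT U ≡ L → U ⊑ ω L
⊑-ω d≡L = ⊑-trans (⊑-≈ (≈-sym (ω-unit d≡L))) (⊑-⊓ₑ (sym d≡L))

patch : Env → Env → Var → Env
patch Γ Δ y w = if does (w ≟V y) then Δ w else Γ w

⊑E-patch : ∀ {Γ Δ y} → Pointwise _⊑_ (Γ y) (Δ y) → Γ ⊑E patch Γ Δ y
⊑E-patch {Γ} {Δ} {y} r with Γ y in Γy | Δ y in Δy | r
... | nothing | nothing | nothing = ⊑E-≃ same
  where
  same : ∀ w → Γ w ≡ patch Γ Δ y w
  same w with w ≟V y
  ... | yes refl = trans Γy (sym Δy)
  ... | no _     = refl
... | just U  | just V  | just U⊑V = ⊑E-pt y U V Γy at-y U⊑V others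
  where
  at-y : patch Γ Δ y y ≡ just V
  at-y with y ≟V y
  ... | yes _  = Δy
  ... | no y≢y = ⊥-elim (y≢y refl)
  others : ∀ w → w ≢ y → Γ w ≡ patch Γ Δ y w
  others w w≢y with w ≟V y
  ... | yes w≡y = ⊥-elim (w≢y w≡y)
  ... | no _    = refl

-- a pointwise subtyping of environments that differ only on a finite list
-- of variables is an environment subtyping: patch one variable at a time
⊑E-pointwise : ∀ (ys : List Var) {Γ Δ} → (∀ v → v ∉ ys → Γ v ≡ Δ v) →
               (∀ v → Pointwise _⊑_ (Γ v) (Δ v)) → Γ ⊑E Δ
⊑E-pointwise []       outside _  = ⊑E-≃ (λ v → outside v (λ ()))
⊑E-pointwise (y ∷ ys) {Γ} {Δ} outside below =
  ⊑E-trans (⊑E-patch (below y)) (⊑E-pointwise ys outside′ below′)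
  where
  outside′ : ∀ v → v ∉ ys → patch Γ Δ y v ≡ Δ v
  outside′ v v∉ys with v ≟V y
  ... | yes _   = refl
  ... | no v≢y  = outside v λ { (here v≡y) → v≢y v≡y ; (there v∈ys) → v∉ys v∈ys }
  below′ : ∀ v → Pointwise _⊑_ (patch Γ Δ y v) (Δ v)
  below′ v with v ≟V y
  ... | yes _ = Pointwise.refl ⊑-refl
  ... | no _  = below v

below-envω : ∀ {Γ} M → OK Γ → DomFv Γ M → ∀ v → Pointwise _⊑_ (Γ v) (envω M v)
below-envω {Γ} M ok D (x , L) with Γ (x , L) in Γx | mem? _≟V_ (x , L) (fv M)
... | just U  | yes _   = just (⊑-ω (ok x L U Γx))
... | just U  | no x∉M  = ⊥-elim (x∉M (proj₁ (D (x , L)) (U , Γx)))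
... | nothing | no _    = nothing
... | nothing | yes x∈M with proj₂ (D (x , L)) x∈M
...   | _ , Γx′ with trans (sym Γx) Γx′
...     | ()

agree-outside-fv : ∀ {Γ} M → DomFv Γ M → ∀ v → v ∉ fv M → Γ v ≡ envω M v
agree-outside-fv {Γ} M D (x , L) x∉M with Γ (x , L) in Γx | mem? _≟V_ (x , L) (fv M)
... | _       | yes x∈M = ⊥-elim (x∉M x∈M)
... | nothing | no _    = refl
... | just U  | no _    = ⊥-elim (x∉M (proj₁ (D (x , L)) (U , Γx)))

-- Part (1): type M by (ω) and weaken the environment from env^ω_M to Γ
ω-typing : ∀ (Γ : Env) (M : Term) (K : Index) → WF M → WfEnv Γ → OK Γ →
           DomFv Γ M → deg M ≡ K → M ∶⟨ Γ ⊢ ω K ⟩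
ω-typing Γ M _ wf wfΓ ok D refl =
  sub (ωr wf) wfΓ (u-ω (deg M))
      (⊑-refl , ⊑E-pointwise (fv M) (agree-outside-fv M D) (below-envω M ok D))

lemma4 : (∀ (Γ : Env) (M : Term) (K : Index) → WF M → WfEnv Γ → OK Γ →
    DomFv Γ M → deg M ≡ K → M ∶⟨ Γ ⊢ ω K ⟩)
    × (∀ (M : Term) (Γ : Env) (U : Ty) → WF M → M ∶⟨ Γ ⊢ U ⟩ → DomFv Γ M)
    × (∀ (M₁ M₂ : Term) (Γ₁ Γ₂ : Env) (U V : Ty) → WF M₁ → WF M₂ →
    M₁ ∶⟨ Γ₁ ⊢ U ⟩ → M₂ ∶⟨ Γ₂ ⊢ V ⟩ →
    (Γ₁ ⋄E Γ₂ → M₁ ⋄ M₂) × (M₁ ⋄ M₂ → Γ₁ ⋄E Γ₂))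
lemma4 =
  ω-typing ,
  (λ _ _ _ _ d → domFv d) ,
  (λ M₁ M₂ _ _ _ _ _ _ d₁ d₂ → ⋄E⇔⋄ M₁ M₂ (domFv d₁) (domFv d₂))
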